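{- Let $n\ge k\ge 3$ be integers and let $D$ be a $k$-partite tournament with $n$ vertices whose niche graph $\mathcal{N}(D)$ is connected and triangle-free. Then $k\in\{3,4,5\}$, and moreover $3\le n\le 6$ if $k=3$, $4\le n\le 5$ if $k=4$, and $n=5$ if $k=5$.
   Context: A $k$-partite tournament is an orientation of a complete $k$-partite graph with $k$ nonempty partite sets. The niche graph $\mathcal{N}(D)$ of a digraph $D$ has vertex set $V(D)$, and two distinct vertices are adjacent iff they have a common out-neighbor in $D$ or a common in-neighbor in $D$. -}

module Defs where

open import Data.Nat using (ℕ)
open import Data.Fin using (Fin)
open import Data.Product using (Σ; ∃; _×_; _,_)
open import Data.Sum using (_⊎_)
open import Relation.Nullary using (¬_)
open import Relation.Binary.PropositionalEquality using (_≡_; _≢_)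
open import Data.Empty using (⊥)

-- A digraph on the vertex set Fin n: an arc relation (irreflexive not required
-- here; it is enforced for multipartite tournaments below).
Digraph : ℕ → Set₁
Digraph n = Fin n → Fin n → Set

record IsMultipartiteTournament {n : ℕ} (k : ℕ) (D : Digraph n) : Set where
  field
    part        : Fin n → Fin k
    nonempty    : ∀ (i : Fin k) → ∃ λ v → part v ≡ i
    noArcInside : ∀ u v → part u ≡ part v → ¬ D u v
    someArc     : ∀ u v → part u ≢ part v → D u v ⊎ D v u
    notBoth     : ∀ u v → D u v → D v u → ⊥

NicheAdj : ∀ {n} → Digraph n → Fin n → Fin n → Set
NicheAdj D u v =
  u ≢ v × ((∃ λ w → D u w × D v w) ⊎ (∃ λ w → D w u × D w v))

data Walk {n : ℕ} (A : Fin n → Fin n → Set) : Fin n → Fin n → Set where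
  here  : ∀ {u} → Walk A u u
  there : ∀ {u v w} → A u v → Walk A v w → Walk A u w

Connected : ∀ {n} → (Fin n → Fin n → Set) → Set
Connected A = ∀ u v → Walk A u v

TriangleFree : ∀ {n} → (Fin n → Fin n → Set) → Set
TriangleFree A = ∀ u v w → A u v → A v w → A u w → ⊥

module Submission where

-- If the niche graph is triangle-free, no vertex has three in-neighbours or
-- three out-neighbours, since they would pairwise share that vertex.  In a
-- multipartite tournament every vertex outside the partite set of v is an in-
-- or out-neighbour of v, so each partite set misses at most 4 vertices:
-- n ≤ |Pᵢ| + 4.  Summing over the k partite sets gives k n ≤ n + 4k, i.e.
-- (k − 1) n ≤ 4k, and together with 3 ≤ k ≤ n this leaves only the listed cases.

open import Defs
open import Algebra.Properties.CommutativeSemigroup using (interchange)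
open import Data.Empty using (⊥; ⊥-elim)
import Data.Fin as Fin
open import Data.Fin using (Fin)
open import Data.List using (List; []; _∷_; length; filter; map; allFin)
open import Data.List.Properties using (length-tabulate; filter-accept; filter-reject)
import Data.List.Relation.Unary.All as All
open import Data.List.Relation.Unary.All using (All; []; _∷_)
open import Data.List.Relation.Unary.All.Properties using (all-filter)
open import Data.List.Relation.Unary.AllPairs using ([]; _∷_)
open import Data.List.Relation.Unary.Unique.Propositional using (Unique)
import Data.List.Relation.Unary.Unique.Propositional.Properties as Unique
open import Data.Nat using (ℕ; suc; _+_; _*_; _≤_; z≤n; s≤s; s≤s⁻¹)
open import Data.Nat.ListAction using (sum)
open import Data.Nat.Properties
open import Data.Product using (_×_; _,_)
open import Data.Sum using (_⊎_; inj₁; inj₂)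
open import Function using (id; _∘_)
open import Relation.Binary using (DecidableEquality)
open import Relation.Binary.PropositionalEquality
  using (_≡_; _≢_; refl; sym; trans; cong; cong₂)
open import Relation.Nullary using (Dec; yes; no; ¬?)
open import Relation.Unary using (Pred; Decidable)

module _ {a p} {A : Set a} {P : Pred A p} (P? : Decidable P) where

  length-filter-cons : ∀ x xs → length (filter P? xs) ≤ length (filter P? (x ∷ xs))
  length-filter-cons x xs with P? x
  ... | yes _ = n≤1+n _
  ... | no  _ = ≤-refl

  length-filter+length-filter-∁ : ∀ xs →
    length (filter P? xs) + length (filter (¬? ∘ P?) xs) ≡ length xs
  length-filter+length-filter-∁ [] = refl
  length-filter+length-filter-∁ (x ∷ xs) with ih ← length-filter+length-filter-∁ xs | P? x
  ... | yes _ = cong suc ih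
  ... | no  _ = trans (+-suc _ _) (cong suc ih)

  length-filter≤2 : (∀ {x y z} → x ≢ y → y ≢ z → x ≢ z → P x → P y → P z → ⊥) →
    ∀ {xs} → Unique xs → length (filter P? xs) ≤ 2
  length-filter≤2 noTriple {xs} unique =
    atMostTwo (Unique.filter⁺ P? unique) (all-filter P? xs)
    where
    atMostTwo : ∀ {ys} → Unique ys → All P ys → length ys ≤ 2
    atMostTwo {[]}              _ _ = z≤n
    atMostTwo {_ ∷ []}          _ _ = s≤s z≤n
    atMostTwo {_ ∷ _ ∷ []}      _ _ = s≤s (s≤s z≤n)
    atMostTwo {_ ∷ _ ∷ _ ∷ _} ((x≢y ∷ x≢z ∷ _) ∷ (y≢z ∷ _) ∷ _) (px ∷ py ∷ pz ∷ _) =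
      ⊥-elim (noTriple x≢y y≢z x≢z px py pz)

module _ {a p q r} {A : Set a} {P : Pred A p} {Q : Pred A q} {R : Pred A r}
         (P? : Decidable P) (Q? : Decidable Q) (R? : Decidable R)
         (cover : ∀ x → P x → Q x ⊎ R x) where

  length-filter-cover : ∀ xs →
    length (filter P? xs) ≤ length (filter Q? xs) + length (filter R? xs)
  length-filter-cover [] = z≤n
  length-filter-cover (x ∷ xs) with ih ← length-filter-cover xs | P? x
  ... | no _ = ≤-trans ih (+-mono-≤ (length-filter-cons Q? x xs) (length-filter-cons R? x xs))
  ... | yes px with cover x px
  ...   | inj₁ qx =
    ≤-trans (s≤s (≤-trans ih (+-monoʳ-≤ _ (length-filter-cons R? x xs))))
            (≤-reflexive (cong (λ ys → length ys + _) (sym (filter-accept Q? qx))))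
  ...   | inj₂ rx =
    ≤-trans (s≤s (≤-trans ih (+-monoˡ-≤ _ (length-filter-cons Q? x xs))))
            (≤-reflexive (trans (sym (+-suc _ _))
                                (cong (λ ys → _ + length ys) (sym (filter-accept R? rx)))))

module _ {a b} {A : Set a} {B : Set b} (_≟_ : DecidableEquality B) (f : A → B) where

  fibreSize : List A → B → ℕ
  fibreSize xs y = length (filter (λ x → f x ≟ y) xs)

  private
    sum-fibreSize-[] : ∀ ys → sum (map (fibreSize []) ys) ≡ 0
    sum-fibreSize-[] []       = refl
    sum-fibreSize-[] (_ ∷ ys) = sum-fibreSize-[] ys

    sum-fibreSize-cons-∉ : ∀ {x xs ys} → All (f x ≢_) ys →
      sum (map (fibreSize (x ∷ xs)) ys) ≡ sum (map (fibreSize xs) ys)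
    sum-fibreSize-cons-∉ []             = refl
    sum-fibreSize-cons-∉ (fx≢y ∷ fx∉ys) =
      cong₂ _+_ (cong length (filter-reject (λ x → f x ≟ _) fx≢y))
                (sum-fibreSize-cons-∉ fx∉ys)

    sum-fibreSize-cons : ∀ x xs {ys} → Unique ys →
      sum (map (fibreSize (x ∷ xs)) ys) ≤ suc (sum (map (fibreSize xs) ys))
    sum-fibreSize-cons x xs {[]} [] = z≤n
    sum-fibreSize-cons x xs {y ∷ ys} (y∉ys ∷ unique) with f x ≟ y
    ... | yes fx≡y = ≤-reflexive (cong (suc ∘ (fibreSize xs y +_))
          (sum-fibreSize-cons-∉ (All.map (λ y≢z fx≡z → y≢z (trans (sym fx≡y) fx≡z)) y∉ys)))
    ... | no _ = ≤-trans (+-monoʳ-≤ _ (sum-fibreSize-cons x xs unique))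
                         (≤-reflexive (+-suc _ _))

  sum-fibreSize≤length : ∀ {ys} → Unique ys → ∀ xs → sum (map (fibreSize xs) ys) ≤ length xs
  sum-fibreSize≤length {ys} _ [] = ≤-reflexive (sum-fibreSize-[] ys)
  sum-fibreSize≤length unique (x ∷ xs) =
    ≤-trans (sum-fibreSize-cons x xs unique) (s≤s (sum-fibreSize≤length unique xs))

length-allFin : ∀ n → length (allFin n) ≡ n
length-allFin n = length-tabulate id

length*≤sum+length* : ∀ {a} {A : Set a} {m c} (g : A → ℕ) → (∀ x → m ≤ g x + c) →
  ∀ xs → length xs * m ≤ sum (map g xs) + length xs * c
length*≤sum+length* g bound []       = z≤n
length*≤sum+length* g bound (x ∷ xs) =
  ≤-trans (+-mono-≤ (bound x) (length*≤sum+length* g bound xs))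
          (≤-reflexive (interchange +-commutativeSemigroup (g x) _ (sum (map g xs)) _))

module _ {n} {D : Digraph n} (D? : ∀ u v → Dec (D u v))
         (triangleFree : TriangleFree (NicheAdj D)) where

  inDegree≤2 : ∀ v {us} → Unique us → length (filter (λ u → D? u v) us) ≤ 2
  inDegree≤2 v = length-filter≤2 (λ u → D? u v) λ x≢y y≢z x≢z xv yv zv →
    triangleFree _ _ _ (x≢y , inj₁ (v , xv , yv)) (y≢z , inj₁ (v , yv , zv))
                       (x≢z , inj₁ (v , xv , zv))

  outDegree≤2 : ∀ v {us} → Unique us → length (filter (D? v) us) ≤ 2
  outDegree≤2 v = length-filter≤2 (D? v) λ x≢y y≢z x≢z vx vy vz →
    triangleFree _ _ _ (x≢y , inj₂ (v , vx , vy)) (y≢z , inj₂ (v , vy , vz))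
                       (x≢z , inj₂ (v , vx , vz))

module _ {n k} {D : Digraph n} (T : IsMultipartiteTournament k D) where
  open IsMultipartiteTournament T

  arc? : ∀ u v → Dec (D u v)
  arc? u v with part u Fin.≟ part v
  ... | yes same = no (noArcInside u v same)
  ... | no different with someArc u v different
  ...   | inj₁ uv = yes uv
  ...   | inj₂ vu = no (λ uv → notBoth u v uv vu)

  partSize : Fin k → ℕ
  partSize = fibreSize Fin._≟_ part (allFin n)

  module _ (triangleFree : TriangleFree (NicheAdj D)) where

    n≤partSize+4 : ∀ i → n ≤ partSize i + 4
    n≤partSize+4 i with nonempty i
    ... | v , refl = begin
      n                                           ≡⟨ length-allFin _ ⟨
      length (allFin n)                           ≡⟨ length-filter+length-filter-∁ inPart? (allFin n) ⟨
      partSize (part v) + length (filter (¬? ∘ inPart?) (allFin n))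
        ≤⟨ +-monoʳ-≤ _ (length-filter-cover (¬? ∘ inPart?) (λ u → arc? u v) (arc? v)
                          (λ u different → someArc u v different) (allFin n)) ⟩
      partSize (part v) + (length (filter (λ u → arc? u v) (allFin n))
                           + length (filter (arc? v) (allFin n)))
        ≤⟨ +-monoʳ-≤ _ (+-mono-≤ (inDegree≤2 arc? triangleFree v allFin-unique)
                                 (outDegree≤2 arc? triangleFree v allFin-unique)) ⟩
      partSize (part v) + 4                       ∎
      where
      open ≤-Reasoning
      inPart? : Decidable (λ u → part u ≡ part v)
      inPart? u = part u Fin.≟ part v
      allFin-unique : Unique (allFin n)
      allFin-unique = Unique.allFin⁺ n

    k*n≤n+k*4 : k * n ≤ n + k * 4
    k*n≤n+k*4 = begin
      k * n                                            ≡⟨ cong (_* n) (length-allFin k) ⟨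
      length (allFin k) * n                            ≤⟨ length*≤sum+length* partSize n≤partSize+4 (allFin k) ⟩
      sum (map partSize (allFin k)) + length (allFin k) * 4
        ≤⟨ +-mono-≤ (sum-fibreSize≤length Fin._≟_ part (Unique.allFin⁺ k) (allFin n))
                    (≤-reflexive (cong (_* 4) (length-allFin k))) ⟩
      length (allFin n) + k * 4                        ≡⟨ cong (_+ k * 4) (length-allFin _) ⟩
      n + k * 4                                        ∎
      where open ≤-Reasoning

solutions-k*n≤n+k*4 : ∀ k n → 3 ≤ k → k ≤ n → k * n ≤ n + k * 4 →
  (k ≡ 3 × 3 ≤ n × n ≤ 6) ⊎ (k ≡ 4 × 4 ≤ n × n ≤ 5) ⊎ (k ≡ 5 × n ≡ 5)
solutions-k*n≤n+k*4 1 n (s≤s ()) _ _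
solutions-k*n≤n+k*4 2 n (s≤s (s≤s ())) _ _
solutions-k*n≤n+k*4 3 n _ k≤n h =
  inj₁ (refl , k≤n , *-cancelˡ-≤ 2 (+-cancelˡ-≤ n _ _ h))
solutions-k*n≤n+k*4 4 n _ k≤n h =
  inj₂ (inj₁ (refl , k≤n , s≤s⁻¹ (*-cancelˡ-< 3 n 6 (≤-<-trans (+-cancelˡ-≤ n _ _ h) (n≤1+n 17)))))
solutions-k*n≤n+k*4 5 n _ k≤n h =
  inj₂ (inj₂ (refl , ≤-antisym (*-cancelˡ-≤ 4 (+-cancelˡ-≤ n _ _ h)) k≤n))
solutions-k*n≤n+k*4 (suc m@(suc (suc (suc (suc (suc j)))))) n _ k≤n h =
  ⊥-elim (<⇒≱ (m≤m+n 5 j) (*-cancelˡ-≤ (suc m) (begin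
    suc m * m  ≡⟨ *-comm (suc m) m ⟩
    m * suc m  ≤⟨ *-monoʳ-≤ m k≤n ⟩
    m * n      ≤⟨ +-cancelˡ-≤ n _ _ h ⟩
    suc m * 4  ∎)))
  where open ≤-Reasoning

lemma4p8 : (n k : ℕ) → 3 ≤ k → k ≤ n → (D : Digraph n) →
    IsMultipartiteTournament k D →
    Connected (NicheAdj D) → TriangleFree (NicheAdj D) →
    (k ≡ 3 × 3 ≤ n × n ≤ 6) ⊎ (k ≡ 4 × 4 ≤ n × n ≤ 5) ⊎ (k ≡ 5 × n ≡ 5)
lemma4p8 n k 3≤k k≤n D T _ triangleFree =
  solutions-k*n≤n+k*4 k n 3≤k k≤n (k*n≤n+k*4 T triangleFree)
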